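{- For every integer $n\ge 1$, let $\hat{d}_n$ be the number of c-derangements of the $n$-dimensional hypercube $Q_n$, and let $\hat{e}_n$ and $\hat{o}_n$ denote the numbers of direct and indirect c-derangements of $Q_n$, respectively. Then \[ \hat{e}_n = \frac{\hat{d}_n + (-1)^n}{2}, \qquad \hat{o}_n = \frac{\hat{d}_n + (-1)^{n+1}}{2}. \]
   Context: Let $Q_n$ be the regular $n$-dimensional hypercube, e.g. $[-1,1]^n\subset\mathbb{R}^n$; its $2n$ facets have centers $\pm e_1,\dots,\pm e_n$. Isometries of $Q_n$ correspond exactly to $n\times n$ signed permutation matrices (permutation matrices with nonzero entries $\pm1$). A c-derangement is an isometry of $Q_n$ fixing no facet, i.e. a signed permutation matrix with no entry $+1$ on its main diagonal. An isometry is direct if its matrix has determinant $1$ and indirect if its determinant is $-1$. -}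

module Defs where

open import Data.Bool using (Bool; true; false; _∧_; not; if_then_else_)
import Data.Bool
open import Data.Nat using (ℕ; zero; suc) renaming (_≟_ to _ℕ≟_)
open import Data.Fin using (Fin; toℕ)
open import Data.Integer using (ℤ; +_; -_; _+_; _*_; _^_)
open import Data.List as List using (List; []; _∷_; concatMap; filter; length; foldr)
open import Data.Vec as Vec using (Vec; []; _∷_; lookup; removeAt; tabulate; transpose; allFin; toList)
open import Relation.Nullary.Decidable using (⌊_⌋)
open import Relation.Binary.PropositionalEquality using (_≡_)
import Data.Integer.Properties as ℤP

-- Square integer matrices, stored as a vector of rows.
Matrix : ℕ → Set
Matrix n = Vec (Vec ℤ n) n

sumℤ : List ℤ → ℤ
sumℤ = foldr _+_ (+ 0)

det : {n : ℕ} → Matrix n → ℤ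
det {zero} [] = + 1
det {suc n} (r ∷ rs) =
  sumℤ (toList (tabulate λ (j : Fin (suc n)) →
    ((- (+ 1)) ^ toℕ j) * (lookup r j * det (Vec.map (λ row → removeAt row j) rs))))

_==ℤ_ : ℤ → ℤ → Bool
a ==ℤ b = ⌊ a ℤP.≟ b ⌋

isZero : ℤ → Bool
isZero a = a ==ℤ (+ 0)

isUnitEntry : ℤ → Bool
isUnitEntry a = isZero a Data.Bool.∨ (a ==ℤ (+ 1)) Data.Bool.∨ (a ==ℤ (- (+ 1)))

allB : {A : Set} → (A → Bool) → List A → Bool
allB p = foldr (λ x b → p x ∧ b) true

nonzeroCount : {n : ℕ} → Vec ℤ n → ℕ
nonzeroCount v = foldr (λ a k → if isZero a then k else suc k) 0 (toList v)

exactlyOneNonzero : {n : ℕ} → Vec ℤ n → Bool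
exactlyOneNonzero v = ⌊ nonzeroCount v ℕ≟ 1 ⌋

isSignedPerm : {n : ℕ} → Matrix n → Bool
isSignedPerm M =
  allB (λ row → allB isUnitEntry (toList row)) (toList M)
  ∧ allB exactlyOneNonzero (toList M)
  ∧ allB exactlyOneNonzero (toList (transpose M))

-- no entry +1 on the main diagonal (no facet fixed)
noFixedFacet : {n : ℕ} → Matrix n → Bool
noFixedFacet {n} M = allB (λ i → not (lookup (lookup M i) i ==ℤ (+ 1))) (toList (allFin n))

isCDerangement : {n : ℕ} → Matrix n → Bool
isCDerangement M = isSignedPerm M ∧ noFixedFacet M

isDirect : {n : ℕ} → Matrix n → Bool
isDirect M = det M ==ℤ (+ 1)

isIndirect : {n : ℕ} → Matrix n → Bool
isIndirect M = det M ==ℤ (- (+ 1))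

vecsOver : {A : Set} → List A → (n : ℕ) → List (Vec A n)
vecsOver xs zero = [] ∷ []
vecsOver xs (suc n) = concatMap (λ x → List.map (x ∷_) (vecsOver xs n)) xs

-- All n×n matrices with entries in {-1, 0, 1} (every signed permutation
-- matrix is among them, each exactly once).
candidateMatrices : (n : ℕ) → List (Matrix n)
candidateMatrices n = vecsOver (vecsOver (- (+ 1) ∷ + 0 ∷ + 1 ∷ []) n) n

countWhere : {n : ℕ} → (Matrix n → Bool) → ℕ
countWhere {n} p = length (List.filter (λ M → p M Data.Bool.≟ true) (candidateMatrices n))

cDerangements : ℕ → ℕ
cDerangements n = countWhere {n} isCDerangement

directCDerangements : ℕ → ℕ
directCDerangements n = countWhere {n} (λ M → isCDerangement M ∧ isDirect M)

indirectCDerangements : ℕ → ℕ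
indirectCDerangements n = countWhere {n} (λ M → isCDerangement M ∧ isIndirect M)

-- A c-derangement is a signed permutation matrix, so its determinant is ±1: hence d̂ = ê + ô and
-- ê − ô is the sum of det M over the c-derangements M, so it suffices to show that this sum is (−1)ⁿ.
-- Prescribe at each diagonal position one of the conditions ≠+1, =-1, ≠±1 (on a signed permutation
-- matrix ≠±1 means = 0). On the signed permutation matrices with ≠±1 at position k, negating row k is
-- an involution that reverses the sign of the determinant, so their determinants cancel and ≠+1 at
-- position k may be replaced by =-1 without changing the sum. Doing so at every position turns the
-- c-derangements (≠+1 everywhere) into the single matrix −I, whose determinant is (−1)ⁿ.

module Submission where

open import Defs
open import Data.Nat using (ℕ; suc; _≥_)
open import Data.Integer using (ℤ; +_; -_; _+_; _*_; _^_)
open import Data.Product using (_×_)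
open import Relation.Binary.PropositionalEquality using (_≡_)

open import Data.Bool as Bool using (Bool; true; false; T; not; _∧_; if_then_else_)
open import Algebra.Bundles using (CommutativeMonoid)
open import Data.Bool.Properties using (T-∧; T-≡; ∧-comm; ∧-commutativeMonoid)
open import Algebra.Properties.CommutativeSemigroup
  (CommutativeMonoid.commutativeSemigroup ∧-commutativeMonoid) using () renaming (x∙yz≈y∙xz to ∧-swapˡ)
open import Data.Fin as Fin using (Fin; zero; suc; toℕ; punchIn)
import Data.Fin.Properties as Finₚ
open import Data.Integer using (0ℤ; 1ℤ; -1ℤ; ∣_∣; -[1+_])
import Data.Integer.Properties as ℤₚ
open import Data.Integer.Tactic.RingSolver using (solve-∀)
open import Data.List as List using (List; []; _∷_; _++_; concatMap; length)
import Data.List.Properties as Listₚ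
open import Data.Nat as Nat using (zero)
import Data.Nat.Properties as Natₚ
open import Data.Unit using (tt)
open import Data.Product using (∃!; _,_; proj₁; proj₂)
open import Data.Sum using (_⊎_; inj₁; inj₂)
open import Data.Vec as Vec
  using (Vec; []; _∷_; lookup; tabulate; replicate; updateAt; _[_]≔_; removeAt; transpose; allFin; toList)
import Data.Vec.Properties as Vecₚ
open import Function using (_∘_; _⇔_; mk⇔; Equivalence)
open import Relation.Binary.Definitions using (DecidableEquality)
open import Relation.Binary.PropositionalEquality
  using (refl; sym; trans; cong; cong₂; subst; _≢_; module ≡-Reasoning)
open import Relation.Nullary using (does; yes; no; contradiction)
open import Relation.Nullary.Decidable
  using (toWitness; fromWitness; does-⇔; T?; decidable-stable; dec-true; dec-false)

private
  variable
    A : Set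
    m n : ℕ

T-⇔⇒≡ : ∀ {x y} → T x ⇔ T y → x ≡ y
T-⇔⇒≡ {x} {y} x⇔y = does-⇔ x⇔y (T? x) (T? y)

when : Bool → ℤ → ℤ
when b a = if b then a else 0ℤ

when-neg : ∀ b a → when b (- a) ≡ - when b a
when-neg true  a = refl
when-neg false a = refl

allB-cong : ∀ {p q : A → Bool} → (∀ x → p x ≡ q x) → ∀ xs → allB p xs ≡ allB q xs
allB-cong p≗q []       = refl
allB-cong p≗q (x ∷ xs) = cong₂ _∧_ (p≗q x) (allB-cong p≗q xs)

T-allB : ∀ (p : A → Bool) (v : Vec A n) → T (allB p (toList v)) ⇔ (∀ i → T (p (lookup v i)))
T-allB p []      = mk⇔ (λ _ ()) (λ _ → tt)
T-allB p (x ∷ v) = mk⇔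
  (λ all → let (px , pv) = Equivalence.to T-∧ all
           in  λ { zero → px ; (suc i) → Equivalence.to (T-allB p v) pv i })
  (λ all → Equivalence.from T-∧ (all zero , Equivalence.from (T-allB p v) (all ∘ suc)))

allB-tabulate : ∀ (p : A → Bool) (f : Fin n → A) →
                allB p (toList (tabulate f)) ≡ allB (p ∘ f) (toList (allFin n))
allB-tabulate {n = zero}  p f = refl
allB-tabulate {n = suc n} p f =
  cong (p (f zero) ∧_) (trans (allB-tabulate p (f ∘ suc)) (sym (allB-tabulate (p ∘ f) Fin.suc)))

T-allB-allFin : ∀ (p : Fin n → Bool) → T (allB p (toList (allFin n))) ⇔ (∀ i → T (p i))
T-allB-allFin p = mk⇔
  (λ all i → subst (T ∘ p) (Vecₚ.lookup-allFin i) (Equivalence.to (T-allB p (allFin _)) all i))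
  (λ all → Equivalence.from (T-allB p (allFin _)) (λ i → all (lookup (allFin _) i)))

allB-allFin-punchIn : ∀ (p : Fin (suc n) → Bool) k →
                      allB p (toList (allFin (suc n))) ≡ p k ∧ allB (p ∘ punchIn k) (toList (allFin n))
allB-allFin-punchIn p zero = cong (p zero ∧_) (allB-tabulate p Fin.suc)
allB-allFin-punchIn {n = suc n} p (suc k) = begin
  p zero ∧ allB p (toList (tabulate suc))
    ≡⟨ cong (p zero ∧_) (allB-tabulate p Fin.suc) ⟩
  p zero ∧ allB (p ∘ suc) (toList (allFin (suc n)))
    ≡⟨ cong (p zero ∧_) (allB-allFin-punchIn (p ∘ suc) k) ⟩
  p zero ∧ (p (suc k) ∧ allB (p ∘ suc ∘ punchIn k) (toList (allFin n)))
    ≡⟨ ∧-swapˡ (p zero) (p (suc k)) _ ⟩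
  p (suc k) ∧ (p zero ∧ allB (p ∘ suc ∘ punchIn k) (toList (allFin n)))
    ≡⟨ cong (λ b → p (suc k) ∧ (p zero ∧ b)) (allB-tabulate (p ∘ punchIn (suc k)) Fin.suc) ⟨
  p (suc k) ∧ allB (p ∘ punchIn (suc k)) (toList (allFin (suc n)))
    ∎
  where open ≡-Reasoning

[]≔-invariant⇒replicate-≡ : ∀ {B : Set} {x y : A} (f : Vec A n → B) →
                            (∀ v k → f (v [ k ]≔ x) ≡ f (v [ k ]≔ y)) →
                            f (replicate n x) ≡ f (replicate n y)
[]≔-invariant⇒replicate-≡ {n = zero}  f swap = refl
[]≔-invariant⇒replicate-≡ {n = suc n} {x = x} {y} f swap =
  trans (swap (replicate (suc n) x) zero)
        ([]≔-invariant⇒replicate-≡ (λ v → f (y ∷ v)) (λ v k → swap (y ∷ v) (suc k)))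

IsUnit : ℤ → Set
IsUnit a = a ≡ 1ℤ ⊎ a ≡ -1ℤ

IsUnit-* : ∀ {a b} → IsUnit a → IsUnit b → IsUnit (a * b)
IsUnit-* (inj₁ refl) (inj₁ refl) = inj₁ refl
IsUnit-* (inj₁ refl) (inj₂ refl) = inj₂ refl
IsUnit-* (inj₂ refl) (inj₁ refl) = inj₂ refl
IsUnit-* (inj₂ refl) (inj₂ refl) = inj₁ refl

IsUnit-^ : ∀ {a} → IsUnit a → ∀ k → IsUnit (a ^ k)
IsUnit-^ u zero    = inj₁ refl
IsUnit-^ u (suc k) = IsUnit-* u (IsUnit-^ u k)

==ℤ-neg : ∀ a b → ((- a) ==ℤ b) ≡ (a ==ℤ (- b))
==ℤ-neg a b = T-⇔⇒≡ (mk⇔ (fromWitness ∘ to ∘ toWitness) (fromWitness ∘ from ∘ toWitness))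
  where
  to : - a ≡ b → a ≡ - b
  to -a≡b = trans (sym (ℤₚ.neg-involutive a)) (cong -_ -a≡b)
  from : a ≡ - b → - a ≡ b
  from a≡-b = trans (cong -_ a≡-b) (ℤₚ.neg-involutive b)

isUnitEntry≡∣∣<ᵇ2 : ∀ a → isUnitEntry a ≡ (∣ a ∣ Nat.<ᵇ 2)
isUnitEntry≡∣∣<ᵇ2 (+ 0)           = refl
isUnitEntry≡∣∣<ᵇ2 (+ 1)           = refl
isUnitEntry≡∣∣<ᵇ2 (+ suc (suc _)) = refl
isUnitEntry≡∣∣<ᵇ2 -[1+ 0 ]        = refl
isUnitEntry≡∣∣<ᵇ2 -[1+ suc _ ]    = refl

isUnitEntry-resp-∣∣ : ∀ {a b} → ∣ a ∣ ≡ ∣ b ∣ → isUnitEntry a ≡ isUnitEntry b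
isUnitEntry-resp-∣∣ {a} {b} ∣a∣≡∣b∣ = begin
  isUnitEntry a   ≡⟨ isUnitEntry≡∣∣<ᵇ2 a ⟩
  ∣ a ∣ Nat.<ᵇ 2  ≡⟨ cong (Nat._<ᵇ 2) ∣a∣≡∣b∣ ⟩
  ∣ b ∣ Nat.<ᵇ 2  ≡⟨ isUnitEntry≡∣∣<ᵇ2 b ⟨
  isUnitEntry b   ∎
  where open ≡-Reasoning

≢0-resp-∣∣ : ∀ {a b} → ∣ a ∣ ≡ ∣ b ∣ → a ≢ 0ℤ → b ≢ 0ℤ
≢0-resp-∣∣ ∣a∣≡∣b∣ a≢0 b≡0 = a≢0 (ℤₚ.∣i∣≡0⇒i≡0 (trans ∣a∣≡∣b∣ (cong ∣_∣ b≡0)))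

-1≢0 : -1ℤ ≢ 0ℤ
-1≢0 ()

unit-nonzero⇒IsUnit : ∀ a → T (isUnitEntry a) → a ≢ 0ℤ → IsUnit a
unit-nonzero⇒IsUnit (+ 0)    _ a≢0 = contradiction refl a≢0
unit-nonzero⇒IsUnit (+ 1)    _ _   = inj₁ refl
unit-nonzero⇒IsUnit -[1+ 0 ] _ _   = inj₂ refl
unit-nonzero⇒IsUnit (+ suc (suc _)) ()
unit-nonzero⇒IsUnit -[1+ suc _ ] ()

-- Sums over lists

∑ : List A → (A → ℤ) → ℤ
∑ xs f = sumℤ (List.map f xs)

∑-cong : ∀ (xs : List A) {f g : A → ℤ} → (∀ x → f x ≡ g x) → ∑ xs f ≡ ∑ xs g
∑-cong []       f≗g = refl
∑-cong (x ∷ xs) f≗g = cong₂ _+_ (f≗g x) (∑-cong xs f≗g)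

∑-+ : ∀ (xs : List A) (f g : A → ℤ) → ∑ xs (λ x → f x + g x) ≡ ∑ xs f + ∑ xs g
∑-+ []       f g = refl
∑-+ (x ∷ xs) f g = begin
  (f x + g x) + ∑ xs (λ x → f x + g x)  ≡⟨ cong (_+_ (f x + g x)) (∑-+ xs f g) ⟩
  (f x + g x) + (∑ xs f + ∑ xs g)       ≡⟨ interchange (f x) (g x) (∑ xs f) (∑ xs g) ⟩
  (f x + ∑ xs f) + (g x + ∑ xs g)       ∎
  where
  open ≡-Reasoning
  interchange : ∀ a b c d → (a + b) + (c + d) ≡ (a + c) + (b + d)
  interchange = solve-∀

∑-neg : ∀ (xs : List A) (f : A → ℤ) → ∑ xs (λ x → - f x) ≡ - ∑ xs f
∑-neg []       f = refl
∑-neg (x ∷ xs) f = trans (cong (_+_ (- f x)) (∑-neg xs f)) (sym (ℤₚ.neg-distrib-+ (f x) (∑ xs f)))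

∑-0 : ∀ (xs : List A) → ∑ xs (λ _ → 0ℤ) ≡ 0ℤ
∑-0 []       = refl
∑-0 (x ∷ xs) = trans (ℤₚ.+-identityˡ _) (∑-0 xs)

∑-++ : ∀ (xs ys : List A) (f : A → ℤ) → ∑ (xs ++ ys) f ≡ ∑ xs f + ∑ ys f
∑-++ []       ys f = sym (ℤₚ.+-identityˡ (∑ ys f))
∑-++ (x ∷ xs) ys f =
  trans (cong (_+_ (f x)) (∑-++ xs ys f)) (sym (ℤₚ.+-assoc (f x) (∑ xs f) (∑ ys f)))

∑-map : ∀ {B : Set} (xs : List A) (g : A → B) (f : B → ℤ) →
        ∑ (List.map g xs) f ≡ ∑ xs (f ∘ g)
∑-map xs g f = cong sumℤ (sym (Listₚ.map-∘ xs))

∑-concatMap : ∀ {B : Set} (xs : List A) (F : A → List B) (f : B → ℤ) →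
              ∑ (concatMap F xs) f ≡ ∑ xs (λ x → ∑ (F x) f)
∑-concatMap []       F f = refl
∑-concatMap (x ∷ xs) F f =
  trans (∑-++ (F x) (concatMap F xs) f) (cong (_+_ (∑ (F x) f)) (∑-concatMap xs F f))

∑-vecsOver-suc : ∀ (xs : List A) m (f : Vec A (suc m) → ℤ) →
                 ∑ (vecsOver xs (suc m)) f ≡ ∑ xs (λ x → ∑ (vecsOver xs m) (λ v → f (x ∷ v)))
∑-vecsOver-suc xs m f =
  trans (∑-concatMap xs _ f) (∑-cong xs (λ x → ∑-map (vecsOver xs m) (x ∷_) f))

length-filter≡∑-when-1 : ∀ (p : A → Bool) (xs : List A) →
  + length (List.filter (λ x → p x Bool.≟ true) xs) ≡ ∑ xs (λ x → when (p x) 1ℤ)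
length-filter≡∑-when-1 p []       = refl
length-filter≡∑-when-1 p (x ∷ xs) with p x
... | true  = cong (_+_ 1ℤ) (length-filter≡∑-when-1 p xs)
... | false = trans (length-filter≡∑-when-1 p xs) (sym (ℤₚ.+-identityˡ _))

SumInvariant : List A → (A → A) → Set
SumInvariant xs h = ∀ f → ∑ xs f ≡ ∑ xs (f ∘ h)

vecsOver-map-SumInvariant : ∀ {xs : List A} {h} → SumInvariant xs h →
                            ∀ m → SumInvariant (vecsOver xs m) (Vec.map h)
vecsOver-map-SumInvariant inv zero    f = refl
vecsOver-map-SumInvariant {xs = xs} {h} inv (suc m) f = begin
  ∑ (vecsOver xs (suc m)) f
    ≡⟨ ∑-vecsOver-suc xs m f ⟩
  ∑ xs (λ x → ∑ (vecsOver xs m) (λ v → f (x ∷ v)))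
    ≡⟨ inv _ ⟩
  ∑ xs (λ x → ∑ (vecsOver xs m) (λ v → f (h x ∷ v)))
    ≡⟨ ∑-cong xs (λ x → vecsOver-map-SumInvariant inv m _) ⟩
  ∑ xs (λ x → ∑ (vecsOver xs m) (λ v → f (h x ∷ Vec.map h v)))
    ≡⟨ ∑-vecsOver-suc xs m (f ∘ Vec.map h) ⟨
  ∑ (vecsOver xs (suc m)) (f ∘ Vec.map h)
    ∎
  where open ≡-Reasoning

vecsOver-updateAt-SumInvariant : ∀ {xs : List A} {h} → SumInvariant xs h →
                                 ∀ m (k : Fin m) → SumInvariant (vecsOver xs m) (λ v → updateAt v k h)
vecsOver-updateAt-SumInvariant {xs = xs} {h} inv (suc m) k f = begin
  ∑ (vecsOver xs (suc m)) f
    ≡⟨ ∑-vecsOver-suc xs m f ⟩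
  ∑ xs (λ x → ∑ (vecsOver xs m) (λ v → f (x ∷ v)))
    ≡⟨ updateHead k ⟩
  ∑ xs (λ x → ∑ (vecsOver xs m) (λ v → f (updateAt (x ∷ v) k h)))
    ≡⟨ ∑-vecsOver-suc xs m (λ v → f (updateAt v k h)) ⟨
  ∑ (vecsOver xs (suc m)) (λ v → f (updateAt v k h))
    ∎
  where
  open ≡-Reasoning
  updateHead : ∀ k → ∑ xs (λ x → ∑ (vecsOver xs m) (λ v → f (x ∷ v)))
                   ≡ ∑ xs (λ x → ∑ (vecsOver xs m) (λ v → f (updateAt (x ∷ v) k h)))
  updateHead zero    = inv _
  updateHead (suc k) = ∑-cong xs (λ x → vecsOver-updateAt-SumInvariant inv m k (λ v → f (x ∷ v)))

≡-neg⇒≡0 : ∀ a → a ≡ - a → a ≡ 0ℤ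
≡-neg⇒≡0 (+ zero) _ = refl

∑-sign-reversing≡0 : ∀ {xs : List A} {h} → SumInvariant xs h →
                     (f : A → ℤ) → (∀ x → f (h x) ≡ - f x) → ∑ xs f ≡ 0ℤ
∑-sign-reversing≡0 {xs = xs} {h} inv f f∘h≡-f =
  ≡-neg⇒≡0 _ (trans (inv f) (trans (∑-cong xs f∘h≡-f) (∑-neg xs f)))

-- w occurs exactly once in xs.
Sifting : DecidableEquality A → List A → A → Set
Sifting _≟_ xs w = ∀ (f : _ → ℤ) → ∑ xs (λ x → when (does (x ≟ w)) (f x)) ≡ f w

vecsOver-Sifting : ∀ {_≟_ : DecidableEquality A} {xs} m (w : Vec A m) →
                   (∀ i → Sifting _≟_ xs (lookup w i)) →
                   Sifting (Vecₚ.≡-dec _≟_) (vecsOver xs m) w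
vecsOver-Sifting zero    []       sift f = ℤₚ.+-identityʳ (f [])
vecsOver-Sifting {A = A} {_≟_ = _≟_} {xs} (suc m) (w₀ ∷ w) sift f = begin
  ∑ (vecsOver xs (suc m)) (λ v → when (does (v ≟ᵛ (w₀ ∷ w))) (f v))
    ≡⟨ ∑-vecsOver-suc xs m _ ⟩
  ∑ xs (λ x → ∑ (vecsOver xs m) (λ v → when (does (x ≟ w₀) ∧ does (v ≟ᵛ w)) (f (x ∷ v))))
    ≡⟨ ∑-cong xs siftTail ⟩
  ∑ xs (λ x → when (does (x ≟ w₀)) (f (x ∷ w)))
    ≡⟨ sift zero (λ x → f (x ∷ w)) ⟩
  f (w₀ ∷ w)
    ∎
  where
  open ≡-Reasoning
  _≟ᵛ_ : ∀ {k} → DecidableEquality (Vec A k)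
  _≟ᵛ_ = Vecₚ.≡-dec _≟_
  siftTail : ∀ x → ∑ (vecsOver xs m) (λ v → when (does (x ≟ w₀) ∧ does (v ≟ᵛ w)) (f (x ∷ v)))
                 ≡ when (does (x ≟ w₀)) (f (x ∷ w))
  siftTail x with does (x ≟ w₀)
  ... | true  = vecsOver-Sifting m w (λ i → sift (suc i)) (λ v → f (x ∷ v))
  ... | false = ∑-0 (vecsOver xs m)

-- Determinants

∑Fin : (Fin n → ℤ) → ℤ
∑Fin f = sumℤ (toList (tabulate f))

∑Fin-cong : ∀ {f g : Fin n → ℤ} → (∀ j → f j ≡ g j) → ∑Fin f ≡ ∑Fin g
∑Fin-cong {zero}  f≗g = refl
∑Fin-cong {suc n} f≗g = cong₂ _+_ (f≗g zero) (∑Fin-cong (f≗g ∘ suc))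

∑Fin-neg : ∀ (f : Fin n → ℤ) → ∑Fin (λ j → - f j) ≡ - ∑Fin f
∑Fin-neg {zero}  f = refl
∑Fin-neg {suc n} f =
  trans (cong (_+_ (- f zero)) (∑Fin-neg (f ∘ suc))) (sym (ℤₚ.neg-distrib-+ (f zero) _))

∑Fin-0 : ∀ (f : Fin n → ℤ) → (∀ j → f j ≡ 0ℤ) → ∑Fin f ≡ 0ℤ
∑Fin-0 {zero}  f f≗0 = refl
∑Fin-0 {suc n} f f≗0 = cong₂ _+_ (f≗0 zero) (∑Fin-0 (f ∘ suc) (f≗0 ∘ suc))

∑Fin-single : ∀ (f : Fin n → ℤ) j → (∀ j′ → j′ ≢ j → f j′ ≡ 0ℤ) → ∑Fin f ≡ f j
∑Fin-single f zero    others = begin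
  f zero + ∑Fin (f ∘ suc)  ≡⟨ cong (_+_ (f zero)) (∑Fin-0 (f ∘ suc) (λ j → others (suc j) λ ())) ⟩
  f zero + 0ℤ              ≡⟨ ℤₚ.+-identityʳ (f zero) ⟩
  f zero                   ∎
  where open ≡-Reasoning
∑Fin-single f (suc j) others = begin
  f zero + ∑Fin (f ∘ suc)  ≡⟨ cong₂ _+_ (others zero λ ()) (∑Fin-single (f ∘ suc) j othersTail) ⟩
  0ℤ + f (suc j)           ≡⟨ ℤₚ.+-identityˡ (f (suc j)) ⟩
  f (suc j)                ∎
  where
  open ≡-Reasoning
  othersTail : ∀ j′ → j′ ≢ j → f (suc j′) ≡ 0ℤ
  othersTail j′ j′≢j = others (suc j′) (j′≢j ∘ Finₚ.suc-injective)

entry : Matrix n → Fin n → Fin n → ℤ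
entry M i j = lookup (lookup M i) j

negateRow : Fin n → Vec (Vec ℤ m) n → Vec (Vec ℤ m) n
negateRow k M = updateAt M k (Vec.map -_)

minor : Vec (Vec ℤ (suc n)) n → Fin (suc n) → Matrix n
minor rs j = Vec.map (λ row → removeAt row j) rs

-- det (r ∷ rs) unfolds to ∑Fin (laplaceTerm r rs).
laplaceTerm : Vec ℤ (suc n) → Vec (Vec ℤ (suc n)) n → Fin (suc n) → ℤ
laplaceTerm r rs j = (-1ℤ ^ toℕ j) * (lookup r j * det (minor rs j))

removeAt-map : ∀ {B : Set} (f : A → B) (v : Vec A (suc n)) j →
               removeAt (Vec.map f v) j ≡ Vec.map f (removeAt v j)
removeAt-map f (x ∷ v)     zero    = refl
removeAt-map f (x ∷ y ∷ v) (suc j) = cong (f x ∷_) (removeAt-map f (y ∷ v) j)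

lookup-removeAt : ∀ (v : Vec A (suc n)) j c → lookup (removeAt v j) c ≡ lookup v (punchIn j c)
lookup-removeAt v j c = begin
  lookup (removeAt v j) c                      ≡⟨ cong (lookup (removeAt v j)) (Finₚ.punchOut-punchIn j) ⟨
  lookup (removeAt v j) (Fin.punchOut j≢jc)    ≡⟨ Vecₚ.removeAt-punchOut v j≢jc ⟩
  lookup v (punchIn j c)                       ∎
  where
  open ≡-Reasoning
  j≢jc : j ≢ punchIn j c
  j≢jc = Finₚ.punchInᵢ≢i j c ∘ sym

entry-minor : ∀ (rs : Vec (Vec ℤ (suc n)) n) j i c → entry (minor rs j) i c ≡ lookup (lookup rs i) (punchIn j c)
entry-minor rs j i c = trans (cong (λ row → lookup row c) (Vecₚ.lookup-map i (λ row → removeAt row j) rs))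
                             (lookup-removeAt (lookup rs i) j c)

minor-negateRow : ∀ k (rs : Vec (Vec ℤ (suc n)) n) j → minor (negateRow k rs) j ≡ negateRow k (minor rs j)
minor-negateRow k rs j = Vecₚ.map-updateAt rs k (removeAt-map -_ (lookup rs k) j)

det-negateRow : ∀ k (M : Matrix n) → det (negateRow k M) ≡ - det M
det-negateRow zero (r ∷ rs) = trans (∑Fin-cong negatedTerm) (∑Fin-neg (laplaceTerm r rs))
  where
  negInFactor : ∀ s a b → s * ((- a) * b) ≡ - (s * (a * b))
  negInFactor = solve-∀
  negatedTerm : ∀ j → laplaceTerm (Vec.map -_ r) rs j ≡ - laplaceTerm r rs j
  negatedTerm j = trans (cong (λ a → (-1ℤ ^ toℕ j) * (a * det (minor rs j))) (Vecₚ.lookup-map j -_ r))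
                        (negInFactor (-1ℤ ^ toℕ j) (lookup r j) (det (minor rs j)))
det-negateRow (suc k) (r ∷ rs) = trans (∑Fin-cong negatedTerm) (∑Fin-neg (laplaceTerm r rs))
  where
  negInCofactor : ∀ s a b → s * (a * (- b)) ≡ - (s * (a * b))
  negInCofactor = solve-∀
  negatedTerm : ∀ j → laplaceTerm r (negateRow k rs) j ≡ - laplaceTerm r rs j
  negatedTerm j = begin
    (-1ℤ ^ toℕ j) * (lookup r j * det (minor (negateRow k rs) j))
      ≡⟨ cong (λ N → (-1ℤ ^ toℕ j) * (lookup r j * det N)) (minor-negateRow k rs j) ⟩
    (-1ℤ ^ toℕ j) * (lookup r j * det (negateRow k (minor rs j)))
      ≡⟨ cong (λ d → (-1ℤ ^ toℕ j) * (lookup r j * d)) (det-negateRow k (minor rs j)) ⟩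
    (-1ℤ ^ toℕ j) * (lookup r j * - det (minor rs j))
      ≡⟨ negInCofactor (-1ℤ ^ toℕ j) (lookup r j) (det (minor rs j)) ⟩
    - laplaceTerm r rs j
      ∎
    where open ≡-Reasoning

entry-negateRow-≡ : ∀ k j (M : Matrix n) → entry (negateRow k M) k j ≡ - entry M k j
entry-negateRow-≡ k j M =
  trans (cong (λ row → lookup row j) (Vecₚ.lookup∘updateAt k M)) (Vecₚ.lookup-map j -_ (lookup M k))

entry-negateRow-≢ : ∀ {i k} j (M : Matrix n) → i ≢ k → entry (negateRow k M) i j ≡ entry M i j
entry-negateRow-≢ {i = i} {k} j M i≢k = cong (λ row → lookup row j) (Vecₚ.lookup∘updateAt′ i k i≢k M)

∣entry-negateRow∣ : ∀ k (M : Matrix n) i j → ∣ entry (negateRow k M) i j ∣ ≡ ∣ entry M i j ∣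
∣entry-negateRow∣ k M i j with i Fin.≟ k
... | yes refl = trans (cong ∣_∣ (entry-negateRow-≡ k j M)) (ℤₚ.∣-i∣≡∣i∣ (entry M k j))
... | no i≢k   = cong ∣_∣ (entry-negateRow-≢ j M i≢k)

minusIdentity : ∀ n → Matrix n
minusIdentity n = tabulate λ i → tabulate λ j → if does (i Fin.≟ j) then -1ℤ else 0ℤ

entry-minusIdentity : ∀ (i j : Fin n) → entry (minusIdentity n) i j ≡ (if does (i Fin.≟ j) then -1ℤ else 0ℤ)
entry-minusIdentity i j =
  trans (cong (λ row → lookup row j) (Vecₚ.lookup∘tabulate _ i)) (Vecₚ.lookup∘tabulate _ j)

entry-minusIdentity-≡ : ∀ (i : Fin n) → entry (minusIdentity n) i i ≡ -1ℤ
entry-minusIdentity-≡ i =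
  trans (entry-minusIdentity i i) (cong (if_then -1ℤ else 0ℤ) (dec-true (i Fin.≟ i) refl))

entry-minusIdentity-≢ : ∀ {i j : Fin n} → i ≢ j → entry (minusIdentity n) i j ≡ 0ℤ
entry-minusIdentity-≢ {i = i} {j} i≢j =
  trans (entry-minusIdentity i j) (cong (if_then -1ℤ else 0ℤ) (dec-false (i Fin.≟ j) i≢j))

det-minusIdentity : ∀ n → det (minusIdentity n) ≡ -1ℤ ^ n
det-minusIdentity zero    = refl
det-minusIdentity (suc n) = begin
  det (minusIdentity (suc n))         ≡⟨ ∑Fin-single (laplaceTerm row₀ rows) zero offDiagonal ⟩
  1ℤ * (-1ℤ * det (minor rows zero))  ≡⟨ ℤₚ.*-identityˡ _ ⟩
  -1ℤ * det (minor rows zero)         ≡⟨ cong (λ N → -1ℤ * det N) (Vecₚ.tabulate-∘ dropFirst lowerRow) ⟨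
  -1ℤ * det (minusIdentity n)         ≡⟨ cong (-1ℤ *_) (det-minusIdentity n) ⟩
  -1ℤ ^ suc n                         ∎
  where
  open ≡-Reasoning
  row₀ : Vec ℤ (suc n)
  row₀ = lookup (minusIdentity (suc n)) zero
  dropFirst : Vec ℤ (suc n) → Vec ℤ n
  dropFirst row = removeAt row zero
  -- tabulate (dropFirst ∘ lowerRow) is minusIdentity n, as suc i ≟ suc j reduces to i ≟ j.
  lowerRow : Fin n → Vec ℤ (suc n)
  lowerRow i = tabulate λ j → if does (suc i Fin.≟ j) then -1ℤ else 0ℤ
  rows : Vec (Vec ℤ (suc n)) n
  rows = tabulate lowerRow
  offDiagonal : ∀ j → j ≢ zero → laplaceTerm row₀ rows j ≡ 0ℤ
  offDiagonal zero    0≢0 = contradiction refl 0≢0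
  offDiagonal (suc j) _   = begin
    (-1ℤ ^ toℕ (suc j)) * (lookup row₀ (suc j) * det (minor rows (suc j)))
      ≡⟨ cong (λ a → (-1ℤ ^ toℕ (suc j)) * (a * det (minor rows (suc j)))) (entry-minusIdentity zero (suc j)) ⟩
    (-1ℤ ^ toℕ (suc j)) * (0ℤ * det (minor rows (suc j)))
      ≡⟨ ℤₚ.*-zeroʳ (-1ℤ ^ toℕ (suc j)) ⟩
    0ℤ
      ∎

-- Signed permutation matrices

SingleNonzero : (Fin n → ℤ) → Set
SingleNonzero f = ∃! _≡_ λ j → f j ≢ 0ℤ

record IsSignedPermutation (E : Fin n → Fin n → ℤ) : Set where
  field
    entries-unit  : ∀ i j → T (isUnitEntry (E i j))
    row-single    : ∀ i → SingleNonzero (E i)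
    column-single : ∀ j → SingleNonzero (λ i → E i j)

SingleNonzero-resp-∣∣ : ∀ {f g : Fin n → ℤ} → (∀ j → ∣ f j ∣ ≡ ∣ g j ∣) →
                        SingleNonzero f → SingleNonzero g
SingleNonzero-resp-∣∣ ∣f∣≗∣g∣ (j , fj≢0 , unique) =
  j , ≢0-resp-∣∣ (∣f∣≗∣g∣ j) fj≢0 , λ gk≢0 → unique (≢0-resp-∣∣ (sym (∣f∣≗∣g∣ _)) gk≢0)

IsSignedPermutation-resp-∣∣ : ∀ {E F : Fin n → Fin n → ℤ} →
                              (∀ i j → ∣ E i j ∣ ≡ ∣ F i j ∣) →
                              IsSignedPermutation E → IsSignedPermutation F
IsSignedPermutation-resp-∣∣ {E = E} {F} ∣E∣≗∣F∣ sp = record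
  { entries-unit  = λ i j → subst T (isUnitEntry-resp-∣∣ {E i j} {F i j} (∣E∣≗∣F∣ i j))
                                    (entries-unit i j)
  ; row-single    = λ i → SingleNonzero-resp-∣∣ (∣E∣≗∣F∣ i) (row-single i)
  ; column-single = λ j → SingleNonzero-resp-∣∣ (λ i → ∣E∣≗∣F∣ i j) (column-single j)
  }
  where open IsSignedPermutation sp

IsSignedPermutation-minor : ∀ {E : Fin (suc n) → Fin (suc n) → ℤ} → IsSignedPermutation E →
                            ∀ {j} → E zero j ≢ 0ℤ → IsSignedPermutation (λ i c → E (suc i) (punchIn j c))
IsSignedPermutation-minor {n = n} {E = E} sp {j} E0j≢0 = record
  { entries-unit  = λ i c → entries-unit (suc i) (punchIn j c)
  ; row-single    = minorRow
  ; column-single = minorColumn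
  }
  where
  open IsSignedPermutation sp
  inRow0⇒j : ∀ {c} → E zero c ≢ 0ℤ → c ≡ j
  inRow0⇒j nz = let (_ , _ , unique) = row-single zero in trans (sym (unique nz)) (unique E0j≢0)
  inColumn-j⇒0 : ∀ {i} → E i j ≢ 0ℤ → i ≡ zero
  inColumn-j⇒0 nz = let (_ , _ , unique) = column-single j in trans (sym (unique nz)) (unique E0j≢0)
  minorRow : ∀ i → SingleNonzero (λ c → E (suc i) (punchIn j c))
  minorRow i with row-single (suc i)
  ... | c₀ , nonzero , unique = c , subst (λ c′ → E (suc i) c′ ≢ 0ℤ) (sym punchIn-c) nonzero ,
                                λ nz → Finₚ.punchIn-injective j c _ (trans punchIn-c (unique nz))
    where
    j≢c₀ : j ≢ c₀
    j≢c₀ refl = Finₚ.0≢1+n (sym (inColumn-j⇒0 nonzero))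
    c : Fin n
    c = Fin.punchOut j≢c₀
    punchIn-c : punchIn j c ≡ c₀
    punchIn-c = Finₚ.punchIn-punchOut j≢c₀
  minorColumn : ∀ c → SingleNonzero (λ i → E (suc i) (punchIn j c))
  minorColumn c with column-single (punchIn j c)
  ... | zero   , nonzero , _      = contradiction (inRow0⇒j nonzero) (Finₚ.punchInᵢ≢i j c)
  ... | suc i₀ , nonzero , unique = i₀ , nonzero , λ nz → Finₚ.suc-injective (unique nz)

nonzeroCount≡0⇔allZero : ∀ (v : Vec ℤ n) → nonzeroCount v ≡ 0 ⇔ (∀ j → lookup v j ≡ 0ℤ)
nonzeroCount≡0⇔allZero []      = mk⇔ (λ _ ()) (λ _ → refl)
nonzeroCount≡0⇔allZero (a ∷ v) with a ℤₚ.≟ + 0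
... | yes refl = mk⇔ (λ count≡0 → λ { zero → refl ; (suc j) → Equivalence.to tail count≡0 j })
                     (λ allZero → Equivalence.from tail (allZero ∘ suc))
  where
  tail : nonzeroCount v ≡ 0 ⇔ (∀ j → lookup v j ≡ 0ℤ)
  tail = nonzeroCount≡0⇔allZero v
... | no a≢0   = mk⇔ (λ ()) (λ allZero → contradiction (allZero zero) a≢0)

nonzeroCount≡1⇔SingleNonzero : ∀ (v : Vec ℤ n) → nonzeroCount v ≡ 1 ⇔ SingleNonzero (lookup v)
nonzeroCount≡1⇔SingleNonzero []      = mk⇔ (λ ()) (λ ())
nonzeroCount≡1⇔SingleNonzero (a ∷ v) with a ℤₚ.≟ + 0
... | yes refl = mk⇔ (shift ∘ Equivalence.to (nonzeroCount≡1⇔SingleNonzero v))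
                     (Equivalence.from (nonzeroCount≡1⇔SingleNonzero v) ∘ unshift)
  where
  shift : SingleNonzero (lookup v) → SingleNonzero (lookup (0ℤ ∷ v))
  shift (j , nonzero , unique) = suc j , nonzero , λ { {zero} 0≢0 → contradiction refl 0≢0
                                                     ; {suc k} nz → cong suc (unique nz) }
  unshift : SingleNonzero (lookup (0ℤ ∷ v)) → SingleNonzero (lookup v)
  unshift (zero  , 0≢0     , _)      = contradiction refl 0≢0
  unshift (suc j , nonzero , unique) = j , nonzero , λ nz → Finₚ.suc-injective (unique nz)
... | no a≢0   = mk⇔ (λ count≡1 → zero , a≢0 , λ {k} →
                           onlyHead (Equivalence.to tail (Natₚ.suc-injective count≡1)) {k})
                     (λ { (j , _ , unique) → cong suc (Equivalence.from tail (tailZero unique)) })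
  where
  tail : nonzeroCount v ≡ 0 ⇔ (∀ j → lookup v j ≡ 0ℤ)
  tail = nonzeroCount≡0⇔allZero v
  onlyHead : (∀ j → lookup v j ≡ 0ℤ) → ∀ {k} → lookup (a ∷ v) k ≢ 0ℤ → zero ≡ k
  onlyHead allZero {zero}  _  = refl
  onlyHead allZero {suc k} nz = contradiction (allZero k) nz
  tailZero : ∀ {j} → (∀ {k} → lookup (a ∷ v) k ≢ 0ℤ → j ≡ k) → ∀ k → lookup v k ≡ 0ℤ
  tailZero unique k = decidable-stable (lookup v k ℤₚ.≟ 0ℤ)
                        (λ nz → Finₚ.0≢1+n (trans (sym (unique a≢0)) (unique nz)))

lookup-transpose : ∀ (M : Vec (Vec A n) m) i j → lookup (lookup (transpose M) j) i ≡ lookup (lookup M i) j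
lookup-transpose {A = A} {n = n} {m = suc m} (as ∷ ass) i j =
  trans (cong (λ column → lookup column i) column-∷) (split i)
  where
  open ≡-Reasoning
  cons : A → Vec A m → Vec A (suc m)
  cons = _∷_
  column-∷ : lookup (transpose (as ∷ ass)) j ≡ lookup as j ∷ lookup (transpose ass) j
  column-∷ = begin
    lookup ((replicate n cons Vec.⊛ as) Vec.⊛ transpose ass) j
      ≡⟨ Vecₚ.lookup-⊛ j (replicate n cons Vec.⊛ as) (transpose ass) ⟩
    lookup (replicate n cons Vec.⊛ as) j (lookup (transpose ass) j)
      ≡⟨ cong (λ f → f (lookup (transpose ass) j)) (Vecₚ.lookup-⊛ j (replicate n cons) as) ⟩
    lookup (replicate n cons) j (lookup as j) (lookup (transpose ass) j)
      ≡⟨ cong (λ f → f (lookup as j) (lookup (transpose ass) j)) (Vecₚ.lookup-replicate j cons) ⟩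
    lookup as j ∷ lookup (transpose ass) j ∎
  split : ∀ i → lookup (lookup as j ∷ lookup (transpose ass) j) i ≡ lookup (lookup (as ∷ ass) i) j
  split zero    = refl
  split (suc i) = lookup-transpose ass i j

isSignedPerm⇔IsSignedPermutation : ∀ (M : Matrix n) → T (isSignedPerm M) ⇔ IsSignedPermutation (entry M)
isSignedPerm⇔IsSignedPermutation M = mk⇔ to from
  where
  rowSingle : ∀ {n} (v : Vec ℤ n) → T (exactlyOneNonzero v) ⇔ SingleNonzero (lookup v)
  rowSingle v = mk⇔ (Equivalence.to (nonzeroCount≡1⇔SingleNonzero v) ∘ toWitness)
                    (fromWitness ∘ Equivalence.from (nonzeroCount≡1⇔SingleNonzero v))
  columnOf : ∀ j i → ∣ lookup (lookup (transpose M) j) i ∣ ≡ ∣ entry M i j ∣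
  columnOf j i = cong ∣_∣ (lookup-transpose M i j)
  unitEntries : T (allB (λ row → allB isUnitEntry (toList row)) (toList M)) ⇔
                (∀ i j → T (isUnitEntry (entry M i j)))
  unitEntries = mk⇔
    (λ h i → Equivalence.to (T-allB isUnitEntry (lookup M i)) (Equivalence.to (T-allB _ M) h i))
    (λ h → Equivalence.from (T-allB _ M) λ i → Equivalence.from (T-allB isUnitEntry (lookup M i)) (h i))
  singleRows : T (allB exactlyOneNonzero (toList M)) ⇔ (∀ i → SingleNonzero (entry M i))
  singleRows = mk⇔
    (λ h i → Equivalence.to (rowSingle (lookup M i)) (Equivalence.to (T-allB _ M) h i))
    (λ h → Equivalence.from (T-allB _ M) λ i → Equivalence.from (rowSingle (lookup M i)) (h i))
  singleColumns : T (allB exactlyOneNonzero (toList (transpose M))) ⇔ (∀ j → SingleNonzero (λ i → entry M i j))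
  singleColumns = mk⇔
    (λ h j → SingleNonzero-resp-∣∣ (columnOf j)
               (Equivalence.to (rowSingle (lookup (transpose M) j)) (Equivalence.to (T-allB _ (transpose M)) h j)))
    (λ h → Equivalence.from (T-allB _ (transpose M)) λ j →
             Equivalence.from (rowSingle (lookup (transpose M) j)) (SingleNonzero-resp-∣∣ (sym ∘ columnOf j) (h j)))
  to : T (isSignedPerm M) → IsSignedPermutation (entry M)
  to sp =
    let (units , singles) = Equivalence.to T-∧ sp
        (rows , columns)  = Equivalence.to T-∧ singles
    in record
      { entries-unit  = Equivalence.to unitEntries units
      ; row-single    = Equivalence.to singleRows rows
      ; column-single = Equivalence.to singleColumns columns
      }
  from : IsSignedPermutation (entry M) → T (isSignedPerm M)
  from sp = Equivalence.from T-∧ ( Equivalence.from unitEntries entries-unit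
                                 , Equivalence.from T-∧ ( Equivalence.from singleRows row-single
                                                        , Equivalence.from singleColumns column-single))
    where open IsSignedPermutation sp

det-IsUnit : ∀ (M : Matrix n) → IsSignedPermutation (entry M) → IsUnit (det M)
det-IsUnit []       _  = inj₁ refl
det-IsUnit (r ∷ rs) sp with IsSignedPermutation.row-single sp zero
... | j , rⱼ≢0 , unique = subst IsUnit (sym (∑Fin-single (laplaceTerm r rs) j vanishing))
  (IsUnit-* (IsUnit-^ (inj₂ refl) (toℕ j))
            (IsUnit-* (unit-nonzero⇒IsUnit (lookup r j) (IsSignedPermutation.entries-unit sp zero j) rⱼ≢0)
                      (det-IsUnit (minor rs j) minorSP)))
  where
  vanishing : ∀ j′ → j′ ≢ j → laplaceTerm r rs j′ ≡ 0ℤ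
  vanishing j′ j′≢j = begin
    (-1ℤ ^ toℕ j′) * (lookup r j′ * det (minor rs j′))
      ≡⟨ cong (λ a → (-1ℤ ^ toℕ j′) * (a * det (minor rs j′))) rⱼ′≡0 ⟩
    (-1ℤ ^ toℕ j′) * 0ℤ
      ≡⟨ ℤₚ.*-zeroʳ (-1ℤ ^ toℕ j′) ⟩
    0ℤ
      ∎
    where
    open ≡-Reasoning
    rⱼ′≡0 : lookup r j′ ≡ 0ℤ
    rⱼ′≡0 = decidable-stable (lookup r j′ ℤₚ.≟ 0ℤ) (λ nz → j′≢j (sym (unique nz)))
  minorSP : IsSignedPermutation (entry (minor rs j))
  minorSP = IsSignedPermutation-resp-∣∣ (λ i c → cong ∣_∣ (sym (entry-minor rs j i c)))
                                        (IsSignedPermutation-minor sp rⱼ≢0)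

isSignedPerm-negateRow : ∀ k (M : Matrix n) → isSignedPerm (negateRow k M) ≡ isSignedPerm M
isSignedPerm-negateRow k M = T-⇔⇒≡ (mk⇔
  (from M ∘ IsSignedPermutation-resp-∣∣ (∣entry-negateRow∣ k M) ∘ to (negateRow k M))
  (from (negateRow k M) ∘ IsSignedPermutation-resp-∣∣ (λ i j → sym (∣entry-negateRow∣ k M i j)) ∘ to M))
  where
  to : ∀ N → T (isSignedPerm N) → IsSignedPermutation (entry N)
  to N = Equivalence.to (isSignedPerm⇔IsSignedPermutation N)
  from : ∀ N → IsSignedPermutation (entry N) → T (isSignedPerm N)
  from N = Equivalence.from (isSignedPerm⇔IsSignedPermutation N)

minusIdentity-IsSignedPermutation : IsSignedPermutation (entry (minusIdentity n))
minusIdentity-IsSignedPermutation = record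
  { entries-unit  = unit
  ; row-single    = λ i → i , diagonal≢0 i , nonzero⇒diagonal
  ; column-single = λ j → j , diagonal≢0 j , sym ∘ nonzero⇒diagonal
  }
  where
  unit : ∀ i j → T (isUnitEntry (entry (minusIdentity _) i j))
  unit i j with i Fin.≟ j
  ... | yes refl = subst (T ∘ isUnitEntry) (sym (entry-minusIdentity-≡ i)) tt
  ... | no i≢j   = subst (T ∘ isUnitEntry) (sym (entry-minusIdentity-≢ i≢j)) tt
  diagonal≢0 : ∀ i → entry (minusIdentity _) i i ≢ 0ℤ
  diagonal≢0 i = -1≢0 ∘ trans (sym (entry-minusIdentity-≡ i))
  nonzero⇒diagonal : ∀ {i j} → entry (minusIdentity _) i j ≢ 0ℤ → i ≡ j
  nonzero⇒diagonal {i} {j} nz = decidable-stable (i Fin.≟ j) (nz ∘ entry-minusIdentity-≢)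

-- Signed permutation matrices with a prescribed diagonal

data DiagonalCondition : Set where
  ≠+1 =-1 ≠±1 : DiagonalCondition

satisfies : DiagonalCondition → ℤ → Bool
satisfies ≠+1 a = not (a ==ℤ 1ℤ)
satisfies =-1 a = a ==ℤ -1ℤ
satisfies ≠±1 a = not (a ==ℤ 1ℤ) ∧ not (a ==ℤ -1ℤ)

hasDiagonal : Vec DiagonalCondition n → Matrix n → Bool
hasDiagonal {n} σ M = allB (λ i → satisfies (lookup σ i) (entry M i i)) (toList (allFin n))

isSignedPermWithDiagonal : Vec DiagonalCondition n → Matrix n → Bool
isSignedPermWithDiagonal σ M = isSignedPerm M ∧ hasDiagonal σ M

hasDiagonalAwayFrom : Vec DiagonalCondition (suc n) → Fin (suc n) → Matrix (suc n) → Bool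
hasDiagonalAwayFrom {n} σ k M = allB (λ j → conditionAt (punchIn k j)) (toList (allFin n))
  where
  conditionAt : Fin (suc n) → Bool
  conditionAt i = satisfies (lookup σ i) (entry M i i)

isSignedPermWithDiagonal-[]≔ : ∀ σ k c (M : Matrix (suc n)) →
  isSignedPermWithDiagonal (σ [ k ]≔ c) M
    ≡ isSignedPerm M ∧ (satisfies c (entry M k k) ∧ hasDiagonalAwayFrom σ k M)
isSignedPermWithDiagonal-[]≔ {n} σ k c M = cong (isSignedPerm M ∧_) (begin
  hasDiagonal (σ [ k ]≔ c) M
    ≡⟨ allB-allFin-punchIn _ k ⟩
  satisfies (lookup (σ [ k ]≔ c) k) (entry M k k) ∧ allB (conditionAt ∘ punchIn k) (toList (allFin n))
    ≡⟨ cong₂ (λ c′ b → satisfies c′ (entry M k k) ∧ b)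
             (Vecₚ.lookup∘updateAt k σ) (allB-cong awayFrom-k (toList (allFin n))) ⟩
  satisfies c (entry M k k) ∧ hasDiagonalAwayFrom σ k M
    ∎)
  where
  open ≡-Reasoning
  conditionAt : Fin (suc n) → Bool
  conditionAt i = satisfies (lookup (σ [ k ]≔ c) i) (entry M i i)
  awayFrom-k : ∀ j → conditionAt (punchIn k j)
                   ≡ satisfies (lookup σ (punchIn k j)) (entry M (punchIn k j) (punchIn k j))
  awayFrom-k j = cong (λ c′ → satisfies c′ (entry M (punchIn k j) (punchIn k j)))
                      (Vecₚ.lookup∘updateAt′ (punchIn k j) k (Finₚ.punchInᵢ≢i k j) σ)

isSignedPermWithDiagonal-negateRow : ∀ σ k (M : Matrix (suc n)) →
  isSignedPermWithDiagonal (σ [ k ]≔ ≠±1) (negateRow k M) ≡ isSignedPermWithDiagonal (σ [ k ]≔ ≠±1) M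
isSignedPermWithDiagonal-negateRow {n} σ k M = begin
  isSignedPermWithDiagonal (σ [ k ]≔ ≠±1) (negateRow k M)
    ≡⟨ isSignedPermWithDiagonal-[]≔ σ k ≠±1 (negateRow k M) ⟩
  isSignedPerm (negateRow k M)
    ∧ (satisfies ≠±1 (entry (negateRow k M) k k) ∧ hasDiagonalAwayFrom σ k (negateRow k M))
    ≡⟨ cong₂ _∧_ (isSignedPerm-negateRow k M) (cong₂ _∧_ diagonal-k awayFrom-k) ⟩
  isSignedPerm M ∧ (satisfies ≠±1 (entry M k k) ∧ hasDiagonalAwayFrom σ k M)
    ≡⟨ isSignedPermWithDiagonal-[]≔ σ k ≠±1 M ⟨
  isSignedPermWithDiagonal (σ [ k ]≔ ≠±1) M
    ∎
  where
  open ≡-Reasoning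
  a : ℤ
  a = entry M k k
  diagonal-k : satisfies ≠±1 (entry (negateRow k M) k k) ≡ satisfies ≠±1 a
  diagonal-k = begin
    satisfies ≠±1 (entry (negateRow k M) k k)
      ≡⟨ cong (satisfies ≠±1) (entry-negateRow-≡ k k M) ⟩
    not ((- a) ==ℤ 1ℤ) ∧ not ((- a) ==ℤ -1ℤ)
      ≡⟨ cong₂ (λ x y → not x ∧ not y) (==ℤ-neg a 1ℤ) (==ℤ-neg a -1ℤ) ⟩
    not (a ==ℤ -1ℤ) ∧ not (a ==ℤ 1ℤ)
      ≡⟨ ∧-comm (not (a ==ℤ -1ℤ)) (not (a ==ℤ 1ℤ)) ⟩
    satisfies ≠±1 a
      ∎
  awayFrom-k : hasDiagonalAwayFrom σ k (negateRow k M) ≡ hasDiagonalAwayFrom σ k M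
  awayFrom-k = allB-cong (λ j → cong (satisfies (lookup σ (punchIn k j)))
                                     (entry-negateRow-≢ (punchIn k j) M (Finₚ.punchInᵢ≢i k j)))
                         (toList (allFin n))

-- candidateMatrices n unfolds to vecsOver (vecsOver entryValues n) n.
entryValues : List ℤ
entryValues = -1ℤ ∷ 0ℤ ∷ 1ℤ ∷ []

candidates-negateRow-SumInvariant : ∀ (k : Fin n) → SumInvariant (candidateMatrices n) (negateRow k)
candidates-negateRow-SumInvariant {n} k =
  vecsOver-updateAt-SumInvariant (vecsOver-map-SumInvariant entryValues-neg n) n k
  where
  entryValues-neg : SumInvariant entryValues -_
  entryValues-neg f = reverse (f -1ℤ) (f 0ℤ) (f 1ℤ)
    where
    reverse : ∀ a b c → a + (b + (c + 0ℤ)) ≡ c + (b + (a + 0ℤ))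
    reverse = solve-∀

detSum : Vec DiagonalCondition n → ℤ
detSum {n} σ = ∑ (candidateMatrices n) (λ M → when (isSignedPermWithDiagonal σ M) (det M))

detSum-≠±1≡0 : ∀ (σ : Vec DiagonalCondition n) k → detSum (σ [ k ]≔ ≠±1) ≡ 0ℤ
detSum-≠±1≡0 {suc n} σ k = ∑-sign-reversing≡0 {xs = candidateMatrices (suc n)} {h = negateRow k}
                                              (candidates-negateRow-SumInvariant k) _ λ M → begin
  when (isSignedPermWithDiagonal (σ [ k ]≔ ≠±1) (negateRow k M)) (det (negateRow k M))
    ≡⟨ cong₂ when (isSignedPermWithDiagonal-negateRow σ k M) (det-negateRow k M) ⟩
  when (isSignedPermWithDiagonal (σ [ k ]≔ ≠±1) M) (- det M)
    ≡⟨ when-neg _ (det M) ⟩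
  - when (isSignedPermWithDiagonal (σ [ k ]≔ ≠±1) M) (det M)
    ∎
  where open ≡-Reasoning

when-≠+1-split : ∀ s a b d → when (s ∧ (satisfies ≠+1 a ∧ b)) d
                           ≡ when (s ∧ (satisfies =-1 a ∧ b)) d + when (s ∧ (satisfies ≠±1 a ∧ b)) d
when-≠+1-split false a b d = refl
when-≠+1-split true  a b d with a ==ℤ 1ℤ in a≟1 | a ==ℤ -1ℤ in a≟-1
... | true  | true  = contradiction (trans (sym (sound a≟1)) (sound a≟-1)) λ ()
  where
  sound : ∀ {c} → (a ==ℤ c) ≡ true → a ≡ c
  sound eq = toWitness (subst T (sym eq) tt)
... | true  | false = refl
... | false | true  = sym (ℤₚ.+-identityʳ (when b d))
... | false | false = sym (ℤₚ.+-identityˡ (when b d))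

detSum-≠+1≡=-1 : ∀ (σ : Vec DiagonalCondition n) k → detSum (σ [ k ]≔ ≠+1) ≡ detSum (σ [ k ]≔ =-1)
detSum-≠+1≡=-1 {suc n} σ k = begin
  detSum (σ [ k ]≔ ≠+1)                          ≡⟨ ∑-cong candidates split ⟩
  ∑ candidates (λ M → with=-1 M + with≠±1 M)     ≡⟨ ∑-+ candidates with=-1 with≠±1 ⟩
  detSum (σ [ k ]≔ =-1) + detSum (σ [ k ]≔ ≠±1)  ≡⟨ cong (_+_ (detSum (σ [ k ]≔ =-1))) (detSum-≠±1≡0 σ k) ⟩
  detSum (σ [ k ]≔ =-1) + 0ℤ                     ≡⟨ ℤₚ.+-identityʳ _ ⟩
  detSum (σ [ k ]≔ =-1)                          ∎
  where
  open ≡-Reasoning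
  candidates : List (Matrix (suc n))
  candidates = candidateMatrices (suc n)
  with=-1 with≠±1 : Matrix (suc n) → ℤ
  with=-1 M = when (isSignedPermWithDiagonal (σ [ k ]≔ =-1) M) (det M)
  with≠±1 M = when (isSignedPermWithDiagonal (σ [ k ]≔ ≠±1) M) (det M)
  split : ∀ M → when (isSignedPermWithDiagonal (σ [ k ]≔ ≠+1) M) (det M) ≡ with=-1 M + with≠±1 M
  split M
    rewrite isSignedPermWithDiagonal-[]≔ σ k ≠+1 M
          | isSignedPermWithDiagonal-[]≔ σ k =-1 M
          | isSignedPermWithDiagonal-[]≔ σ k ≠±1 M
    = when-≠+1-split (isSignedPerm M) (entry M k k) (hasDiagonalAwayFrom σ k M) (det M)

isSignedPermWithDiagonal-=-1⇔≡minusIdentity : ∀ (M : Matrix n) →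
  T (isSignedPermWithDiagonal (replicate n =-1) M) ⇔ M ≡ minusIdentity n
isSignedPermWithDiagonal-=-1⇔≡minusIdentity {n} M = mk⇔ to from
  where
  diagonalCondition : Matrix n → Fin n → Bool
  diagonalCondition N i = satisfies (lookup (replicate n =-1) i) (entry N i i)
  to : T (isSignedPermWithDiagonal (replicate n =-1) M) → M ≡ minusIdentity n
  to h = begin
    M                                      ≡⟨ Vecₚ.tabulate∘lookup M ⟨
    tabulate (lookup M)                    ≡⟨ Vecₚ.tabulate-cong (Vecₚ.tabulate∘lookup ∘ lookup M) ⟨
    tabulate (λ i → tabulate (entry M i))  ≡⟨ Vecₚ.tabulate-cong (Vecₚ.tabulate-cong ∘ entry≡) ⟩
    minusIdentity n                        ∎
    where
    open ≡-Reasoning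
    parts : T (isSignedPerm M) × T (hasDiagonal (replicate n =-1) M)
    parts = Equivalence.to T-∧ h
    open IsSignedPermutation (Equivalence.to (isSignedPerm⇔IsSignedPermutation M) (proj₁ parts))
    diagonal : ∀ i → entry M i i ≡ -1ℤ
    diagonal i = toWitness (subst (λ c → T (satisfies c (entry M i i))) (Vecₚ.lookup-replicate i =-1)
                                  (Equivalence.to (T-allB-allFin (diagonalCondition M)) (proj₂ parts) i))
    entry≡ : ∀ i j → entry M i j ≡ (if does (i Fin.≟ j) then -1ℤ else 0ℤ)
    entry≡ i j with i Fin.≟ j
    ... | yes refl = diagonal i
    ... | no i≢j   = decidable-stable (entry M i j ℤₚ.≟ 0ℤ) λ nz →
      let (_ , _ , unique) = row-single i
      in  i≢j (trans (sym (unique (-1≢0 ∘ trans (sym (diagonal i))))) (unique nz))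
  from : M ≡ minusIdentity n → T (isSignedPermWithDiagonal (replicate n =-1) M)
  from refl = Equivalence.from T-∧
    ( Equivalence.from (isSignedPerm⇔IsSignedPermutation (minusIdentity n))
                       minusIdentity-IsSignedPermutation
    , Equivalence.from (T-allB-allFin (diagonalCondition (minusIdentity n))) λ i →
        subst (λ c → T (satisfies c (entry (minusIdentity n) i i))) (sym (Vecₚ.lookup-replicate i =-1))
              (fromWitness (entry-minusIdentity-≡ i)))

entryValues-Sifting : ∀ a → T (isUnitEntry a) → Sifting ℤₚ._≟_ entryValues a
entryValues-Sifting (+ 0)    _ f = trans (ℤₚ.+-identityˡ _) (ℤₚ.+-identityʳ (f 0ℤ))
entryValues-Sifting (+ 1)    _ f =
  trans (ℤₚ.+-identityˡ _) (trans (ℤₚ.+-identityˡ _) (ℤₚ.+-identityʳ (f 1ℤ)))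
entryValues-Sifting -[1+ 0 ] _ f = ℤₚ.+-identityʳ (f -1ℤ)

detSum-=-1≡det-minusIdentity : detSum (replicate n =-1) ≡ det (minusIdentity n)
detSum-=-1≡det-minusIdentity {n} = begin
  detSum (replicate n =-1)
    ≡⟨ ∑-cong (candidateMatrices n) (λ M → cong (λ b → when b (det M)) (isMinusIdentity M)) ⟩
  ∑ (candidateMatrices n) (λ M → when (does (M ≟ minusIdentity n)) (det M))
    ≡⟨ vecsOver-Sifting n (minusIdentity n) siftRow det ⟩
  det (minusIdentity n)
    ∎
  where
  open ≡-Reasoning
  _≟_ : DecidableEquality (Matrix n)
  _≟_ = Vecₚ.≡-dec (Vecₚ.≡-dec ℤₚ._≟_)
  isMinusIdentity : ∀ M → isSignedPermWithDiagonal (replicate n =-1) M ≡ does (M ≟ minusIdentity n)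
  isMinusIdentity M = does-⇔ (isSignedPermWithDiagonal-=-1⇔≡minusIdentity M) (T? _) (M ≟ minusIdentity n)
  siftRow : ∀ i → Sifting (Vecₚ.≡-dec ℤₚ._≟_) (vecsOver entryValues n) (lookup (minusIdentity n) i)
  siftRow i = vecsOver-Sifting n (lookup (minusIdentity n) i) λ j →
    entryValues-Sifting _ (IsSignedPermutation.entries-unit minusIdentity-IsSignedPermutation i j)

∑det-cDerangements : ∀ n → ∑ (candidateMatrices n) (λ M → when (isCDerangement M) (det M)) ≡ -1ℤ ^ n
∑det-cDerangements n = begin
  ∑ (candidateMatrices n) (λ M → when (isCDerangement M) (det M))
    ≡⟨ ∑-cong (candidateMatrices n) (λ M → cong (λ b → when b (det M)) (cDerangement≡ M)) ⟩
  detSum (replicate n ≠+1)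
    ≡⟨ []≔-invariant⇒replicate-≡ {x = ≠+1} {y = =-1} (detSum {n}) detSum-≠+1≡=-1 ⟩
  detSum (replicate n =-1)
    ≡⟨ detSum-=-1≡det-minusIdentity {n} ⟩
  det (minusIdentity n)
    ≡⟨ det-minusIdentity n ⟩
  -1ℤ ^ n
    ∎
  where
  open ≡-Reasoning
  cDerangement≡ : ∀ M → isCDerangement M ≡ isSignedPermWithDiagonal (replicate n ≠+1) M
  cDerangement≡ M = cong (isSignedPerm M ∧_)
    (allB-cong (λ i → cong (λ c → satisfies c (entry M i i)) (sym (Vecₚ.lookup-replicate i ≠+1)))
               (toList (allFin n)))

-- Counting

IsUnit⇒indicator-sum : ∀ {d} → IsUnit d → 1ℤ ≡ when (d ==ℤ 1ℤ) 1ℤ + when (d ==ℤ -1ℤ) 1ℤ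
IsUnit⇒indicator-sum (inj₁ refl) = refl
IsUnit⇒indicator-sum (inj₂ refl) = refl

IsUnit⇒indicator-difference : ∀ {d} → IsUnit d → when (d ==ℤ 1ℤ) 1ℤ ≡ when (d ==ℤ -1ℤ) 1ℤ + d
IsUnit⇒indicator-difference (inj₁ refl) = refl
IsUnit⇒indicator-difference (inj₂ refl) = refl

cDerangement-det-IsUnit : ∀ (M : Matrix n) → T (isCDerangement M) → IsUnit (det M)
cDerangement-det-IsUnit M h =
  det-IsUnit M (Equivalence.to (isSignedPerm⇔IsSignedPermutation M) (proj₁ (Equivalence.to T-∧ h)))

isDirectCDerangement isIndirectCDerangement : Matrix n → Bool
isDirectCDerangement M = isCDerangement M ∧ isDirect M
isIndirectCDerangement M = isCDerangement M ∧ isIndirect M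

when-cDerangement-split : ∀ (M : Matrix n) →
  when (isCDerangement M) 1ℤ ≡ when (isDirectCDerangement M) 1ℤ + when (isIndirectCDerangement M) 1ℤ
when-cDerangement-split M with isCDerangement M in h
... | true  = IsUnit⇒indicator-sum (cDerangement-det-IsUnit M (Equivalence.from T-≡ h))
... | false = refl

when-direct-difference : ∀ (M : Matrix n) →
  when (isDirectCDerangement M) 1ℤ ≡ when (isIndirectCDerangement M) 1ℤ + when (isCDerangement M) (det M)
when-direct-difference M with isCDerangement M in h
... | true  = IsUnit⇒indicator-difference (cDerangement-det-IsUnit M (Equivalence.from T-≡ h))
... | false = refl

countWhere≡∑ : ∀ (p : Matrix n → Bool) →
               + countWhere p ≡ ∑ (candidateMatrices n) (λ M → when (p M) 1ℤ)
countWhere≡∑ p = length-filter≡∑-when-1 p (candidateMatrices _)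

cDerangements≡direct+indirect : ∀ n → + cDerangements n ≡ + directCDerangements n + + indirectCDerangements n
cDerangements≡direct+indirect n = begin
  + cDerangements n
    ≡⟨ countWhere≡∑ {n} isCDerangement ⟩
  ∑ C (λ M → when (isCDerangement M) 1ℤ)
    ≡⟨ ∑-cong C when-cDerangement-split ⟩
  ∑ C (λ M → when (isDirectCDerangement M) 1ℤ + when (isIndirectCDerangement M) 1ℤ)
    ≡⟨ ∑-+ C _ _ ⟩
  ∑ C (λ M → when (isDirectCDerangement M) 1ℤ) + ∑ C (λ M → when (isIndirectCDerangement M) 1ℤ)
    ≡⟨ cong₂ _+_ (countWhere≡∑ {n} isDirectCDerangement) (countWhere≡∑ {n} isIndirectCDerangement) ⟨
  + directCDerangements n + + indirectCDerangements n
    ∎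
  where
  open ≡-Reasoning
  C : List (Matrix n)
  C = candidateMatrices n

direct≡indirect+[-1]^n : ∀ n → + directCDerangements n ≡ + indirectCDerangements n + -1ℤ ^ n
direct≡indirect+[-1]^n n = begin
  + directCDerangements n
    ≡⟨ countWhere≡∑ {n} isDirectCDerangement ⟩
  ∑ C (λ M → when (isDirectCDerangement M) 1ℤ)
    ≡⟨ ∑-cong C when-direct-difference ⟩
  ∑ C (λ M → when (isIndirectCDerangement M) 1ℤ + when (isCDerangement M) (det M))
    ≡⟨ ∑-+ C _ _ ⟩
  ∑ C (λ M → when (isIndirectCDerangement M) 1ℤ) + ∑ C (λ M → when (isCDerangement M) (det M))
    ≡⟨ cong₂ _+_ (sym (countWhere≡∑ {n} isIndirectCDerangement)) (∑det-cDerangements n) ⟩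
  + indirectCDerangements n + -1ℤ ^ n
    ∎
  where
  open ≡-Reasoning
  C : List (Matrix n)
  C = candidateMatrices n

halves : ∀ {d e o t : ℤ} → d ≡ e + o → e ≡ o + t → (+ 2 * e ≡ d + t) × (+ 2 * o ≡ d + -1ℤ * t)
halves {o = o} {t} refl refl = twiceDirect o t , twiceIndirect o t
  where
  twiceDirect : ∀ o t → + 2 * (o + t) ≡ ((o + t) + o) + t
  twiceDirect = solve-∀
  twiceIndirect : ∀ o t → + 2 * o ≡ ((o + t) + o) + -1ℤ * t
  twiceIndirect = solve-∀

corollary4p4 : (n : ℕ) → n ≥ 1 →
    ((+ 2) * (+ directCDerangements n) ≡ (+ cDerangements n) + ((- (+ 1)) ^ n))
    × ((+ 2) * (+ indirectCDerangements n) ≡ (+ cDerangements n) + ((- (+ 1)) ^ suc n))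
corollary4p4 n _ = halves {t = -1ℤ ^ n} (cDerangements≡direct+indirect n) (direct≡indirect+[-1]^n n)
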